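{- For a cycle $C_n$ of order $n>2$, $P^{(\ell)}(C_n)=0$ for $\ell<\lfloor n/2\rfloor$, and for $\ell\ge\lfloor n/2\rfloor$, \[P^{(\ell)}(C_n)=\begin{cases}1-\left(\frac14\right)^{\ell-n/2+1} & \text{if } n \text{ is even},\\ 1-\frac34\left(\frac14\right)^{\ell-(n-1)/2} & \text{if } n \text{ is odd}.\end{cases}\]
   Context: Probabilistic zero forcing on a graph $G$: vertices are colored blue or white. The process proceeds in rounds $1,2,3,\dots$. In a round, let $S$ be the set of blue vertices at the start of the round; each blue vertex $u$ fires at each of its white neighbors $w$, and each such fire succeeds independently with probability $|N[u]\cap S|/\deg u$, where $N[u]$ is the closed neighborhood of $u$. At the end of the round, every white vertex at which at least one fire succeeded becomes blue. For $B\subseteq V(G)$ and positive integer $\ell$, $P^{(\ell)}_B(G)$ is the probability that all vertices of $G$ are blue after $\ell$ rounds starting with exactly $B$ blue, and $P^{(\ell)}(G)=\max_{v\in V(G)}P^{(\ell)}_{\{v\}}(G)$. -}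

module Defs where

open import Data.Bool using (Bool; true; false; _∧_; _∨_; not; if_then_else_)
open import Data.Nat as ℕ using (ℕ; zero; suc; _%_; _≡ᵇ_)
open import Data.Integer using (+_)
open import Data.Fin using (Fin; toℕ)
open import Data.Fin.Subset using (Subset; inside; outside; ⁅_⁆; _∪_; ⊤)
open import Data.Vec using (lookup; tabulate)
open import Data.List using (List; []; _∷_; map; foldr; concatMap; filter; length; allFin)
open import Data.Product using (_×_; _,_)
open import Data.Rational using (ℚ; _/_; _+_; _*_; _-_; _⊔_; 0ℚ; 1ℚ)
open import Relation.Nullary.Decidable using (does)
open import Data.Fin.Subset.Properties using (_∈?_)

Graph : ℕ → Set
Graph n = Fin n → Fin n → Bool

mem : ∀ {n} → Fin n → Subset n → Bool
mem i S = does (i ∈? S)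

countV : ∀ {n} → (Fin n → Bool) → ℕ
countV {n} p = length (filter (λ i → Data.Bool._≟_ (p i) true) (allFin n))

degree : ∀ {n} → Graph n → Fin n → ℕ
degree G u = countV (G u)

closedNbhdInS : ∀ {n} → Graph n → Subset n → Fin n → ℕ
closedNbhdInS G S u = countV (λ j → (does (Data.Fin._≟_ j u) ∨ G u j) ∧ mem j S)

-- success probability |N[u] ∩ S| / deg u of a fire from u (0 if deg u = 0; such u never fires)
fireProb : ∀ {n} → Graph n → Subset n → Fin n → ℚ
fireProb G S u with degree G u
... | zero  = 0ℚ
... | suc d = + (closedNbhdInS G S u) / suc d

fires : ∀ {n} → Graph n → Subset n → List (Fin n × Fin n)
fires {n} G S =
  concatMap (λ u → concatMap (λ w →
     if mem u S ∧ not (mem w S) ∧ G u w then (u , w) ∷ [] else []) (allFin n))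
   (allFin n)

-- expectation of f(T), where T is S together with every white vertex hit by
-- a successful fire; each fire (u , w) succeeds independently with
-- probability fireProb G S u.
expectFires : ∀ {n} → Graph n → Subset n → List (Fin n × Fin n)
            → Subset n → (Subset n → ℚ) → ℚ
expectFires G S []            T f = f T
expectFires G S ((u , w) ∷ fs) T f =
  fireProb G S u * expectFires G S fs (T ∪ ⁅ w ⁆) f
  + (1ℚ - fireProb G S u) * expectFires G S fs T f

allBlue : ∀ {n} → Subset n → Bool
allBlue {n} S = foldr (λ i b → mem i S ∧ b) true (allFin n)

probAllBlue : ∀ {n} → Graph n → ℕ → Subset n → ℚ
probAllBlue G zero    B = if allBlue B then 1ℚ else 0ℚ
probAllBlue G (suc ℓ) B = expectFires G B (fires G B) B (probAllBlue G ℓ)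

-- P^{(ℓ)}(G) = max over v of P^{(ℓ)}_{{v}}(G)  (probabilities are ≥ 0, so starting the fold at 0 is harmless)
P : ∀ {n} → Graph n → ℕ → ℚ
P {n} G ℓ = foldr _⊔_ 0ℚ (map (λ v → probAllBlue G ℓ ⁅ v ⁆) (allFin n))

cycle : (n : ℕ) → Graph n
cycle (suc k) i j =
  ((suc (toℕ i) % suc k) ≡ᵇ toℕ j) ∨ ((suc (toℕ j) % suc k) ≡ᵇ toℕ i)
cycle zero ()

_^ℚ_ : ℚ → ℕ → ℚ
q ^ℚ zero  = 1ℚ
q ^ℚ suc k = q * (q ^ℚ k)

-- From a single blue vertex v of C_n, v fires at each of its two neighbours with probability
-- |N[v] ∩ {v}| / deg v = 1/2, so the first round ends, each with probability 1/4, in {v}, in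
-- one of two blue arcs of two vertices, or in a blue arc of three vertices. From then on nothing
-- is random: an end vertex of a blue arc of k ≥ 2 vertices has exactly one blue neighbour, so it
-- fires with probability 2/2 = 1, and the arc grows by two vertices per round until it covers
-- C_n, i.e. after ℓ rounds exactly when n ≤ k + 2ℓ. Hence p_ℓ = P^{(ℓ)}_{{v}}(C_n), the same for
-- every v, satisfies
--   p_0 = 0,   p_{ℓ+1} = ¼ [n ≤ 3 + 2ℓ] + ½ [n ≤ 2 + 2ℓ] + ¼ p_ℓ,
-- which vanishes for ℓ < ⌊n/2⌋ and from then on approaches 1 geometrically with ratio ¼.

module Submission where

open import Defs
open import Data.Bool as Bool using (Bool; true; false; _∧_; _∨_; not; if_then_else_; T)
open import Data.Bool.Properties using (T-≡; T-∨; T-∧; ⇔→≡)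
open import Data.Nat as ℕ using (ℕ; zero; suc; _+_; _∸_; _<_; _≤_; _≤ᵇ_; _<ᵇ_; _≡ᵇ_; _%_; s≤s; z≤n)
open import Data.Nat.DivMod
  using (_/_; m≡m%n+[m/n]*n; m*n/n≡m; %-distribˡ-+; m%n%n≡m%n; [m+kn]%n≡m%n; [m+n]%n≡m%n; m%n<n;
         m<n⇒m%n≡m; n%n≡0; m*n%n≡0)
import Data.Nat.Properties as ℕₚ
import Data.Nat.Tactic.RingSolver as NatSolver
open import Data.Fin as Fin using (Fin; toℕ)
import Data.Fin.Properties as Finₚ
open import Data.Fin.Subset using (Subset; _∈_; _∉_; ⁅_⁆; _∪_)
open import Data.Fin.Subset.Properties
  using (x∈⁅x⁆; x∈⁅y⁆⇒x≡y; x∈p∪q⁺; x∈p∪q⁻; ⊆-antisym; _∈?_; ∪-commutativeMonoid)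
open import Algebra.Bundles using (CommutativeMonoid)
import Algebra.Properties.CommutativeSemigroup as CommutativeSemigroupProperties
open import Data.Vec using (lookup; tabulate)
open import Data.Vec.Properties using (lookup∘tabulate; []=⇒lookup; lookup⇒[]=)
open import Data.List as List using (List; []; _∷_; _++_; concat; concatMap; filter; length; allFin)
import Data.List.Properties as Listₚ
open import Data.List.Membership.Propositional using (find; lose) renaming (_∈_ to _∈ₗ_)
open import Data.List.Membership.Propositional.Properties using (∈-allFin; ∈-concatMap⁺; ∈-concatMap⁻)
open import Data.List.Relation.Unary.Any using (here; there)
open import Data.Product using (_×_; _,_; ∃; proj₁; proj₂)
open import Data.Sum as Sum using (_⊎_; inj₁; inj₂; [_,_]′)
open import Data.Sum.Function.Propositional using (_⊎-⇔_)
open import Data.Integer using (+_)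
open import Data.Rational as ℚ using (ℚ; _*_; _-_; 0ℚ; 1ℚ) renaming (_/_ to _/ℚ_)
import Data.Rational.Properties as ℚₚ
import Data.Rational.Solver as ℚSolver
open import Function using (id; _∘_; _∘₂_; _⇔_; mk⇔; Equivalence)
open import Function.Construct.Composition using (_⇔-∘_)
open import Function.Construct.Symmetry using (⇔-sym)
open import Relation.Nullary using (¬_; Dec; does; yes; no; contradiction)
open import Relation.Binary.PropositionalEquality

open Equivalence using (to; from)

T-does : ∀ {P : Set} (d : Dec P) → T (does d) ⇔ P
T-does (yes p) = mk⇔ (λ _ → p) _
T-does (no ¬p) = mk⇔ (λ ()) ¬p

T-not⇔ : ∀ {b} → T (not b) ⇔ (¬ T b)
T-not⇔ {true}  = mk⇔ (λ ()) (λ ¬t → ¬t _)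
T-not⇔ {false} = mk⇔ (λ _ ()) _

module _ {n : ℕ} {i : Fin n} {S : Subset n} where

  mem⇔∈ : T (mem i S) ⇔ i ∈ S
  mem⇔∈ = T-does (i ∈? S)

  ∈-∪⁅⁆⇔ : ∀ {w} → i ∈ S ∪ ⁅ w ⁆ ⇔ (i ∈ S ⊎ i ≡ w)
  ∈-∪⁅⁆⇔ {w} = mk⇔ (Sum.map₂ (x∈⁅y⁆⇒x≡y w) ∘ x∈p∪q⁻ S ⁅ w ⁆)
                   (x∈p∪q⁺ ∘ Sum.map₂ (λ { refl → x∈⁅x⁆ w }))

subset-ext : ∀ {n} {S S′ : Subset n} → (∀ i → i ∈ S ⇔ i ∈ S′) → S ≡ S′
subset-ext h = ⊆-antisym (λ {i} → to (h i)) (λ {i} → from (h i))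

T-allBlue : ∀ {n} {S : Subset n} → T (allBlue S) ⇔ (∀ i → i ∈ S)
T-allBlue {n} {S} = mk⇔ (λ t i → all⁻ (allFin n) t (∈-allFin i)) (all⁺ (allFin n))
  where
  all⁻ : ∀ is → T (List.foldr (λ i b → mem i S ∧ b) true is) → ∀ {i} → i ∈ₗ is → i ∈ S
  all⁻ (j ∷ js) t (here refl) = to mem⇔∈ (proj₁ (to T-∧ t))
  all⁻ (j ∷ js) t (there p)   = all⁻ js (proj₂ (to T-∧ t)) p
  all⁺ : ∀ is → (∀ i → i ∈ S) → T (List.foldr (λ i b → mem i S ∧ b) true is)
  all⁺ []       all-in = _
  all⁺ (j ∷ js) all-in = from T-∧ (from mem⇔∈ (all-in j) , all⁺ js all-in)

length-filter-tabulate : ∀ {A : Set} {n} (q : A → Bool) (g : Fin n → A) →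
  length (filter (λ x → q x Bool.≟ true) (List.tabulate g)) ≡ countV (q ∘ g)
length-filter-tabulate {n = zero}  q g = refl
length-filter-tabulate {n = suc n} q g
  with q (g Fin.zero) | length-filter-tabulate q (g ∘ Fin.suc) | length-filter-tabulate (q ∘ g) Fin.suc
... | true  | ih | ih′ = cong suc (trans ih (sym ih′))
... | false | ih | ih′ = trans ih (sym ih′)

countV-suc : ∀ {n} (p : Fin (suc n) → Bool) →
             countV p ≡ (if p Fin.zero then 1 else 0) + countV (p ∘ Fin.suc)
countV-suc p with p Fin.zero
... | true  = cong suc (length-filter-tabulate p Fin.suc)
... | false = length-filter-tabulate p Fin.suc

countV-none : ∀ {n} (p : Fin n → Bool) → (∀ j → ¬ T (p j)) → countV p ≡ 0
countV-none {zero}  p none = refl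
countV-none {suc n} p none rewrite countV-suc p with p Fin.zero | none Fin.zero
... | true  | ¬p0 = contradiction _ ¬p0
... | false | _   = countV-none (p ∘ Fin.suc) (none ∘ Fin.suc)

countV-one : ∀ {n} (p : Fin n → Bool) x → T (p x) → (∀ j → T (p j) → j ≡ x) → countV p ≡ 1
countV-one {suc n} p Fin.zero px only rewrite countV-suc p with p Fin.zero | px
... | true | _ =
  cong suc (countV-none (p ∘ Fin.suc) (λ j pj → Finₚ.0≢1+n (sym (only (Fin.suc j) pj))))
countV-one {suc n} p (Fin.suc x) px only rewrite countV-suc p with p Fin.zero | only Fin.zero
... | true  | only0 = contradiction (only0 _) Finₚ.0≢1+n
... | false | _     = countV-one (p ∘ Fin.suc) x px (λ j pj → Finₚ.suc-injective (only (Fin.suc j) pj))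

countV-two : ∀ {n} (p : Fin n → Bool) x y → x ≢ y → T (p x) → T (p y) →
             (∀ j → T (p j) → j ≡ x ⊎ j ≡ y) → countV p ≡ 2
countV-two p Fin.zero Fin.zero x≢y _ _ _ = contradiction refl x≢y
countV-two p Fin.zero (Fin.suc y) x≢y px py only rewrite countV-suc p with p Fin.zero | px
... | true | _ = cong suc (countV-one (p ∘ Fin.suc) y py (λ j pj → other (only (Fin.suc j) pj)))
  where
  other : ∀ {j} → Fin.suc j ≡ Fin.zero ⊎ Fin.suc j ≡ Fin.suc y → j ≡ y
  other (inj₂ eq) = Finₚ.suc-injective eq
countV-two p (Fin.suc x) Fin.zero x≢y px py only =
  countV-two p Fin.zero (Fin.suc x) (x≢y ∘ sym) py px (Sum.swap ∘₂ only)
countV-two p (Fin.suc x) (Fin.suc y) x≢y px py only rewrite countV-suc p with p Fin.zero | only Fin.zero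
... | true  | only0 = contradiction (only0 _) [ Finₚ.0≢1+n , Finₚ.0≢1+n ]′
... | false | _     = countV-two (p ∘ Fin.suc) x y (x≢y ∘ cong Fin.suc) px py
                        (λ j pj → Sum.map Finₚ.suc-injective Finₚ.suc-injective (only (Fin.suc j) pj))

concatMap-allFin : ∀ {A : Set} {n} (f : Fin n → List A) → concatMap f (allFin n) ≡ concat (List.tabulate f)
concatMap-allFin f = cong concat (Listₚ.map-tabulate id f)

concat-tabulate-none : ∀ {A : Set} {n} (h : Fin n → List A) → (∀ u → h u ≡ []) →
                       concat (List.tabulate h) ≡ []
concat-tabulate-none {n = zero}  h none = refl
concat-tabulate-none {n = suc n} h none rewrite none Fin.zero =
  concat-tabulate-none (h ∘ Fin.suc) (none ∘ Fin.suc)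

concat-tabulate-one : ∀ {A : Set} {n} (h : Fin n → List A) v → (∀ u → u ≢ v → h u ≡ []) →
                      concat (List.tabulate h) ≡ h v
concat-tabulate-one {n = suc n} h Fin.zero others =
  trans (cong (h Fin.zero ++_) (concat-tabulate-none (h ∘ Fin.suc) (λ u → others (Fin.suc u) (Finₚ.0≢1+n ∘ sym))))
        (Listₚ.++-identityʳ (h Fin.zero))
concat-tabulate-one {n = suc n} h (Fin.suc v) others rewrite others Fin.zero Finₚ.0≢1+n =
  concat-tabulate-one (h ∘ Fin.suc) v (λ u u≢v → others (Fin.suc u) (u≢v ∘ Finₚ.suc-injective))

concat-tabulate-two : ∀ {A : Set} {n} (h : Fin n → List A) x y → x ≢ y →
                      (∀ u → u ≢ x → u ≢ y → h u ≡ []) →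
                      concat (List.tabulate h) ≡ h x ++ h y ⊎ concat (List.tabulate h) ≡ h y ++ h x
concat-tabulate-two h Fin.zero Fin.zero x≢y others = contradiction refl x≢y
concat-tabulate-two h Fin.zero (Fin.suc y) x≢y others =
  inj₁ (cong (h Fin.zero ++_) (concat-tabulate-one (h ∘ Fin.suc) y
         (λ u u≢y → others (Fin.suc u) (Finₚ.0≢1+n ∘ sym) (u≢y ∘ Finₚ.suc-injective))))
concat-tabulate-two h (Fin.suc x) Fin.zero x≢y others =
  Sum.swap (concat-tabulate-two h Fin.zero (Fin.suc x) (x≢y ∘ sym) (λ u u≢0 u≢x → others u u≢x u≢0))
concat-tabulate-two h (Fin.suc x) (Fin.suc y) x≢y others rewrite others Fin.zero Finₚ.0≢1+n Finₚ.0≢1+n =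
  concat-tabulate-two (h ∘ Fin.suc) x y (x≢y ∘ cong Fin.suc)
    (λ u u≢x u≢y → others (Fin.suc u) (u≢x ∘ Finₚ.suc-injective) (u≢y ∘ Finₚ.suc-injective))

module _ {A : Set} {x : A} where

  if-[]-true : ∀ {c} → T c → (if c then x ∷ [] else []) ≡ x ∷ []
  if-[]-true {true} _ = refl

  if-[]-false : ∀ {c} → ¬ T c → (if c then x ∷ [] else []) ≡ []
  if-[]-false {true}  ¬t = contradiction _ ¬t
  if-[]-false {false} _  = refl

  ∈-if-[]⁻ : ∀ {c y} → y ∈ₗ (if c then x ∷ [] else []) → T c × y ≡ x
  ∈-if-[]⁻ {true} (here refl) = _ , refl

-- One round of the process on an arbitrary graph

½ ¼ ¾ : ℚ
½ = + 1 /ℚ 2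
¼ = + 1 /ℚ 4
¾ = + 3 /ℚ 4

module _ {n : ℕ} (G : Graph n) where

  firesAt : Subset n → Fin n → Fin n → Bool
  firesAt S u w = mem u S ∧ not (mem w S) ∧ G u w

  T-firesAt : ∀ {S u w} → T (firesAt S u w) ⇔ (u ∈ S × w ∉ S × T (G u w))
  T-firesAt = mk⇔
    (λ t → let (tu , t′) = to T-∧ t ; (tw , tG) = to T-∧ t′ in
           to mem⇔∈ tu , (λ w∈S → to T-not⇔ tw (from mem⇔∈ w∈S)) , tG)
    (λ (u∈S , w∉S , tG) → from T-∧ (from mem⇔∈ u∈S , from T-∧ (from T-not⇔ (w∉S ∘ to mem⇔∈) , tG)))

  ∈-fires⇔ : ∀ {S u w} → (u , w) ∈ₗ fires G S ⇔ T (firesAt S u w)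
  ∈-fires⇔ {S} {u} {w} = mk⇔ fires⁻
    (λ t → ∈-concatMap⁺ _ (lose (∈-allFin u) (∈-concatMap⁺ _ (lose (∈-allFin w) (cell t)))))
    where
    fires⁻ : (u , w) ∈ₗ fires G S → T (firesAt S u w)
    fires⁻ p with find (∈-concatMap⁻ _ {xs = allFin n} p)
    ... | u′ , _ , q with find (∈-concatMap⁻ _ {xs = allFin n} q)
    ... | w′ , _ , r with ∈-if-[]⁻ {x = u′ , w′} r
    ... | t , refl = t
    cell : T (firesAt S u w) → (u , w) ∈ₗ (if firesAt S u w then (u , w) ∷ [] else [])
    cell t rewrite if-[]-true {x = (u , w)} t = here refl

  fires-⁅⁆ : ∀ {v x y} → x ≢ y → x ≢ v → y ≢ v → (∀ w → T (G v w) ⇔ (w ≡ x ⊎ w ≡ y)) →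
             fires G ⁅ v ⁆ ≡ (v , x) ∷ (v , y) ∷ [] ⊎ fires G ⁅ v ⁆ ≡ (v , y) ∷ (v , x) ∷ []
  fires-⁅⁆ {v} {x} {y} x≢y x≢v y≢v nbrs =
    Sum.map (λ eq → trans fires≡row (trans eq (cong₂ _++_ x-cell y-cell)))
            (λ eq → trans fires≡row (trans eq (cong₂ _++_ y-cell x-cell)))
            (concat-tabulate-two (cell v) x y x≢y silent)
    where
    cell : Fin n → Fin n → List (Fin n × Fin n)
    cell u w = if firesAt ⁅ v ⁆ u w then (u , w) ∷ [] else []
    row : Fin n → List (Fin n × Fin n)
    row u = concatMap (cell u) (allFin n)
    fires≡row : fires G ⁅ v ⁆ ≡ concat (List.tabulate (cell v))
    fires≡row = trans (concatMap-allFin row) (trans (concat-tabulate-one row v idle) (concatMap-allFin (cell v)))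
      where
      idle : ∀ u → u ≢ v → row u ≡ []
      idle u u≢v = trans (concatMap-allFin (cell u)) (concat-tabulate-none (cell u)
        (λ w → if-[]-false (u≢v ∘ x∈⁅y⁆⇒x≡y v ∘ proj₁ ∘ to T-firesAt)))
    silent : ∀ w → w ≢ x → w ≢ y → cell v w ≡ []
    silent w w≢x w≢y = if-[]-false ([ w≢x , w≢y ]′ ∘ to (nbrs w) ∘ proj₂ ∘ proj₂ ∘ to T-firesAt)
    fires-to : ∀ {w} → w ≢ v → w ≡ x ⊎ w ≡ y → T (firesAt ⁅ v ⁆ v w)
    fires-to w≢v nbr = from T-firesAt (x∈⁅x⁆ v , w≢v ∘ x∈⁅y⁆⇒x≡y v , from (nbrs _) nbr)
    x-cell : cell v x ≡ (v , x) ∷ []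
    x-cell = if-[]-true (fires-to x≢v (inj₁ refl))
    y-cell : cell v y ≡ (v , y) ∷ []
    y-cell = if-[]-true (fires-to y≢v (inj₂ refl))

  fireProb-≡ : ∀ S u {d c} → degree G u ≡ suc d → closedNbhdInS G S u ≡ c → fireProb G S u ≡ + c /ℚ suc d
  fireProb-≡ S u deg cl with degree G u
  fireProb-≡ S u refl refl | _ = refl

module _ {n : ℕ} (G : Graph n) (S : Subset n) (u : Fin n) (deg≡2 : degree G u ≡ 2) (u∈S : u ∈ S) where

  private
    T-closedNbhd : ∀ {j} → T ((does (j Fin.≟ u) ∨ G u j) ∧ mem j S) ⇔ ((j ≡ u ⊎ T (G u j)) × j ∈ S)
    T-closedNbhd {j} = mk⇔
      (λ t → let (t₁ , t₂) = to T-∧ t in Sum.map₁ (to (T-does (j Fin.≟ u))) (to T-∨ t₁) , to mem⇔∈ t₂)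
      (λ (h , j∈S) → from T-∧ (from T-∨ (Sum.map₁ (from (T-does (j Fin.≟ u))) h) , from mem⇔∈ j∈S))

  fireProb-one-blue-neighbour : ∀ {x} → x ≢ u → x ∈ S → T (G u x) →
                                (∀ j → T (G u j) → j ∈ S → j ≡ x) → fireProb G S u ≡ 1ℚ
  fireProb-one-blue-neighbour {x} x≢u x∈S ux only = fireProb-≡ G S u deg≡2
    (countV-two _ u x (x≢u ∘ sym) (from T-closedNbhd (inj₁ refl , u∈S)) (from T-closedNbhd (inj₂ ux , x∈S)) blue)
    where
    blue : ∀ j → _ → j ≡ u ⊎ j ≡ x
    blue j t with to T-closedNbhd t
    ... | inj₁ j≡u , _   = inj₁ j≡u
    ... | inj₂ uj  , j∈S = inj₂ (only j uj j∈S)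

  fireProb-no-blue-neighbour : (∀ j → T (G u j) → j ∉ S) → fireProb G S u ≡ ½
  fireProb-no-blue-neighbour white = fireProb-≡ G S u deg≡2
    (countV-one _ u (from T-closedNbhd (inj₁ refl , u∈S)) blue)
    where
    blue : ∀ j → _ → j ≡ u
    blue j t with to T-closedNbhd t
    ... | inj₁ j≡u , _   = j≡u
    ... | inj₂ uj  , j∈S = contradiction j∈S (white j uj)

addTargets : ∀ {n} → List (Fin n × Fin n) → Subset n → Subset n
addTargets []             T = T
addTargets ((_ , w) ∷ fs) T = addTargets fs (T ∪ ⁅ w ⁆)

∈-addTargets⇔ : ∀ {n} fs {T : Subset n} {i} → i ∈ addTargets fs T ⇔ (i ∈ T ⊎ ∃ λ u → (u , i) ∈ₗ fs)
∈-addTargets⇔ [] = mk⇔ inj₁ [ id , (λ { (_ , ()) }) ]′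
∈-addTargets⇔ ((u , w) ∷ fs) {T} {i} = mk⇔
  ([ Sum.map₂ (λ { refl → u , here refl }) ∘ to ∈-∪⁅⁆⇔ , (λ (u′ , p) → inj₂ (u′ , there p)) ]′
     ∘ to (∈-addTargets⇔ fs))
  (from (∈-addTargets⇔ fs) ∘ [ inj₁ ∘ from ∈-∪⁅⁆⇔ ∘ inj₁ , hit ]′)
  where
  hit : (∃ λ u′ → (u′ , i) ∈ₗ (u , w) ∷ fs) → i ∈ T ∪ ⁅ w ⁆ ⊎ ∃ λ u′ → (u′ , i) ∈ₗ fs
  hit (_ , here refl) = inj₁ (from ∈-∪⁅⁆⇔ (inj₂ refl))
  hit (u′ , there p)  = inj₂ (u′ , p)

module _ {n : ℕ} (G : Graph n) (S : Subset n) (f : Subset n → ℚ) where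
  open ℚSolver.+-*-Solver

  expectFires-certain : ∀ fs T → (∀ {u w} → (u , w) ∈ₗ fs → fireProb G S u ≡ 1ℚ) →
                        expectFires G S fs T f ≡ f (addTargets fs T)
  expectFires-certain []             T certain = refl
  expectFires-certain ((u , w) ∷ fs) T certain rewrite certain (here refl) =
    trans (identity (expectFires G S fs (T ∪ ⁅ w ⁆) f) (expectFires G S fs T f))
          (expectFires-certain fs (T ∪ ⁅ w ⁆) (certain ∘ there))
    where
    identity : ∀ a b → 1ℚ * a ℚ.+ (1ℚ - 1ℚ) * b ≡ a
    identity = solve 2 (λ a b → con 1ℚ :* a :+ (con 1ℚ :- con 1ℚ) :* b := a) refl

  expectFires-halves : ∀ {u u′ x y} T → fireProb G S u ≡ ½ → fireProb G S u′ ≡ ½ →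
    expectFires G S ((u , x) ∷ (u′ , y) ∷ []) T f ≡
    ¼ * f ((T ∪ ⁅ x ⁆) ∪ ⁅ y ⁆) ℚ.+ ¼ * f (T ∪ ⁅ x ⁆) ℚ.+ ¼ * f (T ∪ ⁅ y ⁆) ℚ.+ ¼ * f T
  expectFires-halves {x = x} {y} T p≡½ p′≡½ rewrite p≡½ | p′≡½ =
    halves (f ((T ∪ ⁅ x ⁆) ∪ ⁅ y ⁆)) (f (T ∪ ⁅ x ⁆)) (f (T ∪ ⁅ y ⁆)) (f T)
    where
    halves : ∀ a b c d → ½ * (½ * a ℚ.+ (1ℚ - ½) * b) ℚ.+ (1ℚ - ½) * (½ * c ℚ.+ (1ℚ - ½) * d) ≡
                         ¼ * a ℚ.+ ¼ * b ℚ.+ ¼ * c ℚ.+ ¼ * d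
    halves = solve 4 (λ a b c d →
      con ½ :* (con ½ :* a :+ (con 1ℚ :- con ½) :* b) :+ (con 1ℚ :- con ½) :* (con ½ :* c :+ (con 1ℚ :- con ½) :* d)
      := con ¼ :* a :+ con ¼ :* b :+ con ¼ :* c :+ con ¼ :* d) refl

P-const : ∀ {n} (G : Graph (suc n)) ℓ {c} → 0ℚ ℚ.≤ c → (∀ v → probAllBlue G ℓ ⁅ v ⁆ ≡ c) →
          P G ℓ ≡ c
P-const {n} G ℓ {c} 0≤c all≡c = max-const Fin.zero (List.tabulate Fin.suc)
  where
  g : Fin (suc n) → ℚ
  g v = probAllBlue G ℓ ⁅ v ⁆
  max-const : ∀ v vs → List.foldr ℚ._⊔_ 0ℚ (List.map g (v ∷ vs)) ≡ c
  max-const v []        rewrite all≡c v = ℚₚ.p≥q⇒p⊔q≡p 0≤c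
  max-const v (v′ ∷ vs) rewrite all≡c v | max-const v′ vs = ℚₚ.⊔-idem c

-- The recurrence for a single starting vertex

indicator : Bool → ℚ
indicator b = if b then 1ℚ else 0ℚ

indicator-true : ∀ {b} → T b → indicator b ≡ 1ℚ
indicator-true {true} _ = refl

indicator-false : ∀ {b} → ¬ T b → indicator b ≡ 0ℚ
indicator-false {true}  ¬t = contradiction _ ¬t
indicator-false {false} _  = refl

indicator-nonneg : ∀ b → 0ℚ ℚ.≤ indicator b
indicator-nonneg true  = ℚₚ.nonNegative⁻¹ 1ℚ
indicator-nonneg false = ℚₚ.≤-refl

arcProb : ℕ → ℕ → ℕ → ℚ
arcProb n k ℓ = indicator (n ≤ᵇ k + (ℓ + ℓ))

arcProb-suc : ∀ n k ℓ → arcProb n (2 + k) ℓ ≡ arcProb n k (suc ℓ)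
arcProb-suc n k ℓ = cong (λ x → indicator (n ≤ᵇ x)) (two-more-vertices k ℓ)
  where
  two-more-vertices : ∀ k ℓ → 2 + k + (ℓ + ℓ) ≡ k + (suc ℓ + suc ℓ)
  two-more-vertices = NatSolver.solve-∀

arcProb-full : ∀ {n k ℓ} → n ≤ k + (ℓ + ℓ) → arcProb n k ℓ ≡ 1ℚ
arcProb-full n≤ = indicator-true (ℕₚ.≤⇒≤ᵇ n≤)

arcProb-short : ∀ {n k ℓ} → k + (ℓ + ℓ) < n → arcProb n k ℓ ≡ 0ℚ
arcProb-short {n} {k} {ℓ} short = indicator-false (ℕₚ.<⇒≱ short ∘ ℕₚ.≤ᵇ⇒≤ n (k + (ℓ + ℓ)))

singletonProb : ℕ → ℕ → ℚ
singletonProb n zero    = 0ℚ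
singletonProb n (suc ℓ) = ¼ * arcProb n 3 ℓ ℚ.+ ½ * arcProb n 2 ℓ ℚ.+ ¼ * singletonProb n ℓ

singletonProb-nonneg : ∀ n ℓ → 0ℚ ℚ.≤ singletonProb n ℓ
singletonProb-nonneg n zero    = ℚₚ.≤-refl
singletonProb-nonneg n (suc ℓ) =
  +-nonneg (+-nonneg (¼* (indicator-nonneg (n ≤ᵇ 3 + (ℓ + ℓ)))) (½* (indicator-nonneg (n ≤ᵇ 2 + (ℓ + ℓ)))))
           (¼* (singletonProb-nonneg n ℓ))
  where
  +-nonneg : ∀ {p q} → 0ℚ ℚ.≤ p → 0ℚ ℚ.≤ q → 0ℚ ℚ.≤ p ℚ.+ q
  +-nonneg = ℚₚ.+-mono-≤
  ¼* : ∀ {p} → 0ℚ ℚ.≤ p → 0ℚ ℚ.≤ ¼ * p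
  ¼* = ℚₚ.*-monoˡ-≤-nonNeg ¼
  ½* : ∀ {p} → 0ℚ ℚ.≤ p → 0ℚ ℚ.≤ ½ * p
  ½* = ℚₚ.*-monoˡ-≤-nonNeg ½

private
  3+2ℓ<n : ∀ {n h ℓ} → h + h ≤ n → suc ℓ < h → 3 + (ℓ + ℓ) < n
  3+2ℓ<n {ℓ = ℓ} h+h≤n ℓ<h =
    ℕₚ.≤-trans (ℕₚ.≤-reflexive (4+2ℓ ℓ)) (ℕₚ.≤-trans (ℕₚ.+-mono-≤ ℓ<h ℓ<h) h+h≤n)
    where
    4+2ℓ : ∀ ℓ → 4 + (ℓ + ℓ) ≡ suc (suc ℓ) + suc (suc ℓ)
    4+2ℓ = NatSolver.solve-∀

singletonProb-early : ∀ {n h} → h + h ≤ n → ∀ {ℓ} → ℓ < h → singletonProb n ℓ ≡ 0ℚ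
singletonProb-early h+h≤n {zero}  _    = refl
singletonProb-early h+h≤n {suc ℓ} ℓ<h
  rewrite arcProb-short {k = 3} {ℓ} (3+2ℓ<n h+h≤n ℓ<h)
        | arcProb-short {k = 2} {ℓ} (ℕₚ.<-trans (ℕₚ.n<1+n _) (3+2ℓ<n h+h≤n ℓ<h))
        | singletonProb-early h+h≤n (ℕₚ.<-trans (ℕₚ.n<1+n ℓ) ℓ<h) = refl

singletonProb-suc-full : ∀ {n ℓ} → n ≤ 2 + (ℓ + ℓ) →
                         singletonProb n (suc ℓ) ≡ ¼ * 1ℚ ℚ.+ ½ * 1ℚ ℚ.+ ¼ * singletonProb n ℓ
singletonProb-suc-full {n} {ℓ} n≤ = cong₂ (λ a b → ¼ * a ℚ.+ ½ * b ℚ.+ ¼ * singletonProb n ℓ)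
  (arcProb-full {n} {3} {ℓ} (ℕₚ.m≤n⇒m≤1+n n≤)) (arcProb-full {n} {2} {ℓ} n≤)

singletonProb-geometric : ∀ {n ℓ₀ c} → n ≤ 2 + (ℓ₀ + ℓ₀) → singletonProb n ℓ₀ ≡ 1ℚ - c →
                          ∀ d → singletonProb n (ℓ₀ + d) ≡ 1ℚ - c * ¼ ^ℚ d
singletonProb-geometric {ℓ₀ = ℓ₀} {c} _ base zero rewrite ℕₚ.+-identityʳ ℓ₀ | ℚₚ.*-identityʳ c = base
singletonProb-geometric {n} {ℓ₀} {c} full base (suc d) = begin
  singletonProb n (ℓ₀ + suc d)                       ≡⟨ cong (singletonProb n) (ℕₚ.+-suc ℓ₀ d) ⟩
  singletonProb n (suc (ℓ₀ + d))                     ≡⟨ singletonProb-suc-full {n} {ℓ₀ + d} still-full ⟩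
  ¼ * 1ℚ ℚ.+ ½ * 1ℚ ℚ.+ ¼ * singletonProb n (ℓ₀ + d) ≡⟨ cong (λ p → ¼ * 1ℚ ℚ.+ ½ * 1ℚ ℚ.+ ¼ * p) ih ⟩
  ¼ * 1ℚ ℚ.+ ½ * 1ℚ ℚ.+ ¼ * (1ℚ - c * ¼ ^ℚ d)       ≡⟨ step c (¼ ^ℚ d) ⟩
  1ℚ - c * ¼ ^ℚ suc d                                ∎
  where
  open ≡-Reasoning
  open ℚSolver.+-*-Solver
  ih = singletonProb-geometric {n} {ℓ₀} {c} full base d
  still-full : n ≤ 2 + ((ℓ₀ + d) + (ℓ₀ + d))
  still-full = ℕₚ.≤-trans full (s≤s (s≤s (ℕₚ.+-mono-≤ (ℕₚ.m≤m+n ℓ₀ d) (ℕₚ.m≤m+n ℓ₀ d))))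
  step : ∀ c q → ¼ * 1ℚ ℚ.+ ½ * 1ℚ ℚ.+ ¼ * (1ℚ - c * q) ≡ 1ℚ - c * (¼ * q)
  step = solve 2 (λ c q → con ¼ :* con 1ℚ :+ con ½ :* con 1ℚ :+ con ¼ :* (con 1ℚ :- c :* q)
                          := con 1ℚ :- c :* (con ¼ :* q)) refl

singletonProb-even : ∀ {n h ℓ} → 2 < n → n ≡ h + h → h ≤ ℓ →
                     singletonProb n ℓ ≡ 1ℚ - ¼ ^ℚ (ℓ ∸ h + 1)
singletonProb-even {h = zero} 2<n refl _ = contradiction 2<n λ ()
singletonProb-even {n} {suc h} {ℓ} _ n≡ h≤ℓ with ℓ ∸ suc h | ℕₚ.m+[n∸m]≡n h≤ℓ
... | d | refl = trans (singletonProb-geometric {n} {suc h} {¼} full base d)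
                       (cong (λ e → 1ℚ - ¼ ^ℚ e) (ℕₚ.+-comm 1 d))
  where
  full : n ≤ 2 + (suc h + suc h)
  full = ℕₚ.≤-trans (ℕₚ.≤-reflexive n≡) (ℕₚ.m≤n+m _ 2)
  n≤2+2h : n ≤ 2 + (h + h)
  n≤2+2h = ℕₚ.≤-reflexive (trans n≡ (cong suc (ℕₚ.+-suc h h)))
  base : singletonProb n (suc h) ≡ 1ℚ - ¼
  base rewrite arcProb-full {n} {3} {h} (ℕₚ.m≤n⇒m≤1+n n≤2+2h) | arcProb-full {n} {2} {h} n≤2+2h
             | singletonProb-early (ℕₚ.≤-reflexive (sym n≡)) (ℕₚ.n<1+n h) = refl

singletonProb-odd : ∀ {n h ℓ} → 2 < n → n ≡ suc (h + h) → h ≤ ℓ →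
                    singletonProb n ℓ ≡ 1ℚ - ¾ * ¼ ^ℚ (ℓ ∸ h)
singletonProb-odd {h = zero} 2<n refl _ = contradiction 2<n λ { (s≤s ()) }
singletonProb-odd {n} {suc h} {ℓ} _ n≡ h≤ℓ with ℓ ∸ suc h | ℕₚ.m+[n∸m]≡n h≤ℓ
... | d | refl = singletonProb-geometric {n} {suc h} {¾} full base d
  where
  full : n ≤ 2 + (suc h + suc h)
  full = ℕₚ.≤-trans (ℕₚ.≤-reflexive n≡) (ℕₚ.n≤1+n _)
  n≡3+2h : n ≡ 3 + (h + h)
  n≡3+2h = trans n≡ (cong (suc ∘ suc) (ℕₚ.+-suc h h))
  base : singletonProb n (suc h) ≡ 1ℚ - ¾
  base rewrite arcProb-full {n} {3} {h} (ℕₚ.≤-reflexive n≡3+2h)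
             | arcProb-short {n} {2} {h} (ℕₚ.≤-reflexive (sym n≡3+2h))
             | singletonProb-early (ℕₚ.≤-trans (ℕₚ.n≤1+n _) (ℕₚ.≤-reflexive (sym n≡))) (ℕₚ.n<1+n h) = refl

[m%d+n]%d≡[m+n]%d : ∀ m n d .{{_ : ℕ.NonZero d}} → (m % d + n) % d ≡ (m + n) % d
[m%d+n]%d≡[m+n]%d m n d = begin
  (m % d + n) % d           ≡⟨ %-distribˡ-+ (m % d) n d ⟩
  (m % d % d + n % d) % d   ≡⟨ cong (λ x → (x + n % d) % d) (m%n%n≡m%n m d) ⟩
  (m % d + n % d) % d       ≡⟨ %-distribˡ-+ m n d ⟨
  (m + n) % d               ∎
  where open ≡-Reasoning

<-suc⇔ : ∀ {x t} → x < suc t ⇔ (x < t ⊎ x ≡ t)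
<-suc⇔ = mk⇔ ℕₚ.m<1+n⇒m<n∨m≡n [ ℕₚ.m<n⇒m<1+n , (λ { refl → ℕₚ.n<1+n _ }) ]′

private
  k*2≡k+k : ∀ k → k ℕ.* 2 ≡ k + k
  k*2≡k+k = NatSolver.solve-∀

n≡n%2+[n/2+n/2] : ∀ n → n ≡ n % 2 + (n / 2 + n / 2)
n≡n%2+[n/2+n/2] n = trans (m≡m%n+[m/n]*n n 2) (cong (λ x → n % 2 + x) (k*2≡k+k (n / 2)))

n/2+n/2≤n : ∀ n → n / 2 + n / 2 ≤ n
n/2+n/2≤n n = ℕₚ.≤-trans (ℕₚ.m≤n+m _ (n % 2)) (ℕₚ.≤-reflexive (sym (n≡n%2+[n/2+n/2] n)))

n%2≡0⇒n≡n/2+n/2 : ∀ n → n % 2 ≡ 0 → n ≡ n / 2 + n / 2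
n%2≡0⇒n≡n/2+n/2 n even = trans (n≡n%2+[n/2+n/2] n) (cong (_+ (n / 2 + n / 2)) even)

n%2≡1⇒n≡1+n/2+n/2 : ∀ n → n % 2 ≡ 1 → n ≡ suc (n / 2 + n / 2)
n%2≡1⇒n≡1+n/2+n/2 n odd = trans (n≡n%2+[n/2+n/2] n) (cong (_+ (n / 2 + n / 2)) odd)

n%2≡1⇒[n∸1]/2≡n/2 : ∀ n → n % 2 ≡ 1 → (n ∸ 1) / 2 ≡ n / 2
n%2≡1⇒[n∸1]/2≡n/2 n odd =
  trans (cong (λ k → (k ∸ 1) / 2) (trans (n%2≡1⇒n≡1+n/2+n/2 n odd) (cong suc (sym (k*2≡k+k (n / 2))))))
        (m*n/n≡m (n / 2) 2)

-- The cycle C_N, N = m + 1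

module Cycle (m : ℕ) (2≤m : 2 ≤ m) where

  N : ℕ
  N = suc m

  G : Graph N
  G = cycle N

  1<N : 1 < N
  1<N = s≤s (ℕₚ.≤-trans (s≤s z≤n) 2≤m)

  m<N : m < N
  m<N = ℕₚ.n<1+n m

  rotate : ℕ → ℕ → ℕ
  rotate r x = (x + r) % N

  rotate-rotate : ∀ r s x → rotate s (rotate r x) ≡ rotate (r + s) x
  rotate-rotate r s x = trans ([m%d+n]%d≡[m+n]%d (x + r) s N) (cong (_% N) (ℕₚ.+-assoc x r s))

  rotate-by-multiple : ∀ k x → rotate (k ℕ.* N) x ≡ x % N
  rotate-by-multiple k x = [m+kn]%n≡m%n x k N

  -- m ≡ -1 (mod N), so a rotation by m * r undoes a rotation by r.
  rotate-inverse : ∀ r x → rotate (m ℕ.* r) (rotate r x) ≡ x % N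
  rotate-inverse r x =
    trans (rotate-rotate r (m ℕ.* r) x) (trans (cong (λ s → rotate s x) (ℕₚ.*-comm N r)) (rotate-by-multiple r x))

  rotate-inverseʳ : ∀ r x → rotate r (rotate (m ℕ.* r) x) ≡ x % N
  rotate-inverseʳ r x = trans (rotate-rotate (m ℕ.* r) r x)
    (trans (cong (λ s → rotate s x) (trans (ℕₚ.+-comm (m ℕ.* r) r) (ℕₚ.*-comm N r))) (rotate-by-multiple r x))

  rotate-injective : ∀ r {x y} → x < N → y < N → rotate r x ≡ rotate r y → x ≡ y
  rotate-injective r {x} {y} x<N y<N eq = begin
    x                             ≡⟨ m<n⇒m%n≡m x<N ⟨
    x % N                         ≡⟨ rotate-inverse r x ⟨
    rotate (m ℕ.* r) (rotate r x) ≡⟨ cong (rotate (m ℕ.* r)) eq ⟩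
    rotate (m ℕ.* r) (rotate r y) ≡⟨ rotate-inverse r y ⟩
    y % N                         ≡⟨ m<n⇒m%n≡m y<N ⟩
    y                             ∎
    where open ≡-Reasoning

  offset : ℕ → Fin N → ℕ
  offset r i = rotate r (toℕ i)

  offset<N : ∀ r i → offset r i < N
  offset<N r i = m%n<n (toℕ i + r) N

  vertexAt : ℕ → ℕ → Fin N
  vertexAt r t = Fin.fromℕ< (m%n<n (t + m ℕ.* r) N)

  offset-vertexAt : ∀ r {t} → t < N → offset r (vertexAt r t) ≡ t
  offset-vertexAt r {t} t<N =
    trans (cong (rotate r) (Finₚ.toℕ-fromℕ< (m%n<n (t + m ℕ.* r) N)))
          (trans (rotate-inverseʳ r t) (m<n⇒m%n≡m t<N))

  offset-injective : ∀ r {i j} → offset r i ≡ offset r j → i ≡ j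
  offset-injective r {i} {j} = Finₚ.toℕ-injective ∘ rotate-injective r (Finₚ.toℕ<n i) (Finₚ.toℕ<n j)

  offset≡⇔ : ∀ r {i t} → t < N → offset r i ≡ t ⇔ i ≡ vertexAt r t
  offset≡⇔ r t<N = mk⇔ (λ eq → offset-injective r (trans eq (sym (offset-vertexAt r t<N))))
                       (λ { refl → offset-vertexAt r t<N })

  centre : Fin N → ℕ
  centre u = m ℕ.* toℕ u

  offset-centre : ∀ u → offset (centre u) u ≡ 0
  offset-centre u = trans (cong (_% N) (ℕₚ.*-comm N (toℕ u))) (m*n%n≡0 (toℕ u) N)

  succ pred : ℕ → ℕ
  succ x = suc x % N
  pred x = (x + m) % N

  succ-% : ∀ x → succ (x % N) ≡ succ x
  succ-% x = trans (cong (_% N) (ℕₚ.+-comm 1 (x % N)))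
                   (trans ([m%d+n]%d≡[m+n]%d x 1 N) (cong (_% N) (ℕₚ.+-comm x 1)))

  offset-suc : ∀ r i → offset (suc r) i ≡ succ (offset r i)
  offset-suc r i = trans (cong (_% N) (ℕₚ.+-suc (toℕ i) r)) (sym (succ-% (toℕ i + r)))

  rotate-succ : ∀ r x → rotate r (succ x) ≡ succ (rotate r x)
  rotate-succ r x = trans ([m%d+n]%d≡[m+n]%d (suc x) r N) (sym (succ-% (x + r)))

  succ-< : ∀ {x} → x < m → succ x ≡ suc x
  succ-< x<m = m<n⇒m%n≡m (s≤s x<m)

  succ-0 : succ 0 ≡ 1
  succ-0 = succ-< (ℕₚ.≤-trans (s≤s z≤n) 2≤m)

  succ-m : succ m ≡ 0
  succ-m = n%n≡0 N

  pred-0 : pred 0 ≡ m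
  pred-0 = m<n⇒m%n≡m m<N

  pred-suc : ∀ {x} → x < N → pred (suc x) ≡ x
  pred-suc {x} x<N = trans (cong (_% N) (sym (ℕₚ.+-suc x m))) (trans ([m+n]%n≡m%n x N) (m<n⇒m%n≡m x<N))

  pred-succ : ∀ {x} → x < N → pred (succ x) ≡ x
  pred-succ {x} x<N = trans ([m%d+n]%d≡[m+n]%d (suc x) m N) (pred-suc x<N)

  succ-pred : ∀ {x} → x < N → succ (pred x) ≡ x
  succ-pred {x} x<N = trans (succ-% (x + m)) (pred-suc {x} x<N)

  ≡succ⇔≡pred : ∀ {x y} → x < N → y < N → y ≡ succ x ⇔ x ≡ pred y
  ≡succ⇔≡pred x<N y<N = mk⇔ (λ { refl → sym (pred-succ x<N) }) (λ { refl → sym (succ-pred y<N) })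

  succ≡⇔-rotate : ∀ r {x y} → y < N → succ x ≡ y ⇔ succ (rotate r x) ≡ rotate r y
  succ≡⇔-rotate r y<N = mk⇔ (λ eq → trans (sym (rotate-succ r _)) (cong (rotate r) eq))
                            (λ eq → rotate-injective r (m%n<n (suc _) N) y<N (trans (rotate-succ r _) eq))

  adjacent⇔ : ∀ r {i j} → T (G i j) ⇔ (offset r j ≡ succ (offset r i) ⊎ offset r j ≡ pred (offset r i))
  adjacent⇔ r {i} {j} =
    (≡-sym⇔ ⊎-⇔ (≡succ⇔≡pred (offset<N r j) (offset<N r i) ⇔-∘ ≡-sym⇔))
    ⇔-∘ ((succ≡⇔-rotate r (Finₚ.toℕ<n j) ⊎-⇔ succ≡⇔-rotate r (Finₚ.toℕ<n i))
    ⇔-∘ ((T-≡ᵇ ⊎-⇔ T-≡ᵇ)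
    ⇔-∘ T-∨))
    where
    ≡-sym⇔ : ∀ {A : Set} {a b : A} → a ≡ b ⇔ b ≡ a
    ≡-sym⇔ = mk⇔ sym sym
    T-≡ᵇ : ∀ {a b} → T (a ≡ᵇ b) ⇔ a ≡ b
    T-≡ᵇ {a} {b} = mk⇔ (ℕₚ.≡ᵇ⇒≡ a b) (ℕₚ.≡⇒≡ᵇ a b)

  neighbours⇔ : ∀ {u j} → T (G u j) ⇔ (j ≡ vertexAt (centre u) 1 ⊎ j ≡ vertexAt (centre u) m)
  neighbours⇔ {u} = (offset≡⇔ (centre u) 1<N ⊎-⇔ offset≡⇔ (centre u) m<N) ⇔-∘ adjacent-centre
    where
    adjacent-centre : ∀ {j} → T (G u j) ⇔ (offset (centre u) j ≡ 1 ⊎ offset (centre u) j ≡ m)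
    adjacent-centre {j} = subst₂ (λ a b → T (G u j) ⇔ (offset (centre u) j ≡ a ⊎ offset (centre u) j ≡ b))
      (trans (cong succ (offset-centre u)) succ-0) (trans (cong pred (offset-centre u)) pred-0)
      (adjacent⇔ (centre u))

  neighbours-distinct : ∀ u → vertexAt (centre u) 1 ≢ vertexAt (centre u) m
  neighbours-distinct u eq = ℕₚ.<⇒≢ 2≤m (begin
    1                                         ≡⟨ offset-vertexAt (centre u) 1<N ⟨
    offset (centre u) (vertexAt (centre u) 1) ≡⟨ cong (offset (centre u)) eq ⟩
    offset (centre u) (vertexAt (centre u) m) ≡⟨ offset-vertexAt (centre u) m<N ⟩
    m                                         ∎)
    where open ≡-Reasoning

  degree≡2 : ∀ u → degree G u ≡ 2
  degree≡2 u = countV-two (G u) _ _ (neighbours-distinct u)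
    (from neighbours⇔ (inj₁ refl)) (from neighbours⇔ (inj₂ refl)) (λ j → to neighbours⇔)

  -- arc (suc r) k starts one vertex before arc r k.
  arc : ℕ → ℕ → Subset N
  arc r k = tabulate (λ i → offset r i <ᵇ k)

  ∈-arc⇔ : ∀ {r k i} → i ∈ arc r k ⇔ offset r i < k
  ∈-arc⇔ {r} {k} {i} = mk⇔
    (λ i∈ → ℕₚ.<ᵇ⇒< _ _ (from T-≡ (trans (sym (lookup∘tabulate inArc i)) ([]=⇒lookup i∈))))
    (λ lt → lookup⇒[]= i (arc r k) (trans (lookup∘tabulate inArc i) (to T-≡ (ℕₚ.<⇒<ᵇ lt))))
    where
    inArc : Fin N → Bool
    inArc j = offset r j <ᵇ k

  ⁅⁆≡arc : ∀ v → ⁅ v ⁆ ≡ arc (centre v) 1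
  ⁅⁆≡arc v = subset-ext λ i → mk⇔
    (λ i∈⁅v⁆ → from ∈-arc⇔ (subst (λ j → offset (centre v) j < 1) (sym (x∈⁅y⁆⇒x≡y v i∈⁅v⁆))
                                 (ℕₚ.≤-reflexive (cong suc (offset-centre v)))))
    (λ i∈arc → subst (_∈ ⁅ v ⁆)
                     (sym (offset-injective (centre v) (trans (ℕₚ.n<1⇒n≡0 (to ∈-arc⇔ i∈arc)) (sym (offset-centre v)))))
                     (x∈⁅x⁆ v))

  succ<suc⇔ : ∀ {x t} → x < N → succ x < suc t ⇔ (x ≡ m ⊎ x < t)
  succ<suc⇔ {x} x<N with ℕₚ.m≤n⇒m<n∨m≡n (ℕₚ.≤-pred x<N)
  ... | inj₁ x<m rewrite succ-< x<m =
    mk⇔ (inj₂ ∘ ℕ.s<s⁻¹) [ (λ x≡m → contradiction x≡m (ℕₚ.<⇒≢ x<m)) , s≤s ]′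
  ... | inj₂ refl rewrite succ-m = mk⇔ (λ _ → inj₁ refl) (λ _ → s≤s z≤n)

  ∈-arc-suc⇔ : ∀ {r t i} → i ∈ arc (suc r) (suc t) ⇔ (offset r i ≡ m ⊎ offset r i < t)
  ∈-arc-suc⇔ {r} {t} {i} =
    succ<suc⇔ (offset<N r i) ⇔-∘ subst (λ o → i ∈ arc (suc r) (suc t) ⇔ o < suc t) (offset-suc r i) ∈-arc⇔

  arc-∪-next : ∀ r {t} → t < N → arc r t ∪ ⁅ vertexAt r t ⁆ ≡ arc r (suc t)
  arc-∪-next r t<N = subset-ext λ i →
    ⇔-sym ∈-arc⇔ ⇔-∘ (⇔-sym <-suc⇔ ⇔-∘ ((∈-arc⇔ ⊎-⇔ ⇔-sym (offset≡⇔ r t<N)) ⇔-∘ ∈-∪⁅⁆⇔))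

  arc-∪-last : ∀ r {t} → arc r t ∪ ⁅ vertexAt r m ⁆ ≡ arc (suc r) (suc t)
  arc-∪-last r = subset-ext λ i →
    ⇔-sym ∈-arc-suc⇔ ⇔-∘ (⊎-swap⇔ ⇔-∘ ((∈-arc⇔ ⊎-⇔ ⇔-sym (offset≡⇔ r m<N)) ⇔-∘ ∈-∪⁅⁆⇔))
    where
    ⊎-swap⇔ : ∀ {A B : Set} → (A ⊎ B) ⇔ (B ⊎ A)
    ⊎-swap⇔ = mk⇔ Sum.swap Sum.swap

  allBlue-arc : ∀ r k → allBlue (arc r k) ≡ (N ≤ᵇ k)
  allBlue-arc r k = ⇔→≡ (T-≡ ⇔-∘ ((⇔-sym T-≤ᵇ ⇔-∘ (all-offsets ⇔-∘ T-allBlue)) ⇔-∘ ⇔-sym T-≡))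
    where
    T-≤ᵇ : T (N ≤ᵇ k) ⇔ N ≤ k
    T-≤ᵇ = mk⇔ (ℕₚ.≤ᵇ⇒≤ N k) ℕₚ.≤⇒≤ᵇ
    all-offsets : (∀ i → i ∈ arc r k) ⇔ N ≤ k
    all-offsets = mk⇔ (λ all-in → subst (_< k) (offset-vertexAt r m<N) (to ∈-arc⇔ (all-in (vertexAt r m))))
                      (λ N≤k i → from ∈-arc⇔ (ℕₚ.<-≤-trans (offset<N r i) N≤k))

  module _ {r t : ℕ} where

    private
      boundary : ∀ {x y} → x < N → x < suc t → ¬ y < suc t → y ≡ succ x ⊎ y ≡ pred x →
                 (x ≡ t × y ≡ suc t) ⊎ (x ≡ 0 × y ≡ m)
      boundary {x} x<N x<k y≮k (inj₁ y≡succx) with ℕₚ.m≤n⇒m<n∨m≡n (ℕₚ.≤-pred x<N)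
      ... | inj₁ x<m = inj₁ (x≡t , trans y≡suc (cong suc x≡t))
        where
        y≡suc = trans y≡succx (succ-< x<m)
        x≡t = ℕₚ.≤-antisym (ℕₚ.≤-pred x<k) (ℕₚ.≤-pred (subst (suc t ≤_) y≡suc (ℕₚ.≮⇒≥ y≮k)))
      ... | inj₂ refl = contradiction (subst (_< suc t) (sym (trans y≡succx succ-m)) (s≤s z≤n)) y≮k
      boundary {zero}   _ _   _   (inj₂ y≡predx) = inj₂ (refl , trans y≡predx pred-0)
      boundary {suc x′} x<N x<k y≮k (inj₂ y≡predx) =
        contradiction (subst (_< suc t) (sym (trans y≡predx (pred-suc (ℕₚ.<-trans (ℕₚ.n<1+n x′) x<N))))
                             (ℕₚ.<-trans (ℕₚ.n<1+n x′) x<k)) y≮k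

      fire-from : ∀ {u w} → offset r u < suc t → ¬ offset r w < suc t → T (G u w) →
                  (u , w) ∈ₗ fires G (arc r (suc t))
      fire-from {u} {w} u∈ w∉ uw = from (∈-fires⇔ G {arc r (suc t)} {u} {w})
        (from (T-firesAt G) (from (∈-arc⇔ {r} {suc t} {u}) u∈ , w∉ ∘ to ∈-arc⇔ , uw))

    arc-fire : ∀ {u w} → (u , w) ∈ₗ fires G (arc r (suc t)) →
               suc t < N × ((offset r u ≡ t × offset r w ≡ suc t) ⊎ (offset r u ≡ 0 × offset r w ≡ m))
    arc-fire {u} {w} fire with to (T-firesAt G {arc r (suc t)} {u} {w}) (to (∈-fires⇔ G) fire)
    ... | u∈S , w∉S , uw =
      ℕₚ.≤-<-trans (ℕₚ.≮⇒≥ w≮k) (offset<N r w) ,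
      boundary (offset<N r u) (to ∈-arc⇔ u∈S) w≮k (to (adjacent⇔ r {u} {w}) uw)
      where w≮k = w∉S ∘ from (∈-arc⇔ {r} {suc t} {w})

    fire-next : suc t < N → (vertexAt r t , vertexAt r (suc t)) ∈ₗ fires G (arc r (suc t))
    fire-next k<N = fire-from
      (subst (_< suc t) (sym ot) (ℕₚ.n<1+n t))
      (λ w∈ → ℕₚ.n≮n (suc t) (subst (_< suc t) ow w∈))
      (from (adjacent⇔ r {vertexAt r t} {vertexAt r (suc t)})
            (inj₁ (trans ow (sym (trans (cong succ ot) (succ-< (ℕ.s<s⁻¹ k<N)))))))
      where
      ot = offset-vertexAt r (ℕₚ.<-trans (ℕₚ.n<1+n t) k<N)
      ow = offset-vertexAt r k<N

    fire-last : suc t < N → (vertexAt r 0 , vertexAt r m) ∈ₗ fires G (arc r (suc t))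
    fire-last k<N = fire-from
      (subst (_< suc t) (sym o0) (s≤s z≤n))
      (λ w∈ → ℕₚ.<⇒≱ (subst (_< suc t) om w∈) (ℕ.s<s⁻¹ k<N))
      (from (adjacent⇔ r {vertexAt r 0} {vertexAt r m}) (inj₂ (trans om (sym (trans (cong pred o0) pred-0)))))
      where
      o0 = offset-vertexAt r (s≤s z≤n)
      om = offset-vertexAt r m<N

    arc-grows : addTargets (fires G (arc r (suc t))) (arc r (suc t)) ≡ arc (suc r) (suc (suc (suc t)))
    arc-grows = subset-ext λ i → ⇔-sym ∈-arc-suc⇔ ⇔-∘ (mk⇔ (grown i) (reached i) ⇔-∘ ∈-addTargets⇔ _)
      where
      S = arc r (suc t)
      grown : ∀ i → i ∈ S ⊎ (∃ λ u → (u , i) ∈ₗ fires G S) → offset r i ≡ m ⊎ offset r i < suc (suc t)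
      grown i (inj₁ i∈S) = inj₂ (ℕₚ.m<n⇒m<1+n (to ∈-arc⇔ i∈S))
      grown i (inj₂ (u , fire)) with arc-fire fire
      ... | _ , inj₁ (_ , oi≡k) = inj₂ (ℕₚ.≤-reflexive (cong suc oi≡k))
      ... | _ , inj₂ (_ , oi≡m) = inj₁ oi≡m
      fire-to : ∀ {i u s} → s < N → offset r i ≡ s → (u , vertexAt r s) ∈ₗ fires G S →
                ∃ λ u → (u , i) ∈ₗ fires G S
      fire-to s<N oi≡s fire = _ , subst (λ j → (_ , j) ∈ₗ fires G S) (sym (to (offset≡⇔ r s<N) oi≡s)) fire
      reached : ∀ i → offset r i ≡ m ⊎ offset r i < suc (suc t) → i ∈ S ⊎ (∃ λ u → (u , i) ∈ₗ fires G S)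
      reached i (inj₁ oi≡m) with suc t ℕₚ.<? N
      ... | yes k<N = inj₂ (fire-to m<N oi≡m (fire-last k<N))
      ... | no  k≮N = inj₁ (from ∈-arc⇔ (subst (_< suc t) (sym oi≡m) (ℕₚ.<-≤-trans m<N (ℕₚ.≮⇒≥ k≮N))))
      reached i (inj₂ oi<k+1) with to <-suc⇔ oi<k+1
      ... | inj₁ oi<k = inj₁ (from ∈-arc⇔ oi<k)
      ... | inj₂ oi≡k = inj₂ (fire-to k<N oi≡k (fire-next k<N))
        where k<N = subst (_< N) oi≡k (offset<N r i)

  arc-fireProb : ∀ {r t u w} → (u , w) ∈ₗ fires G (arc r (suc (suc t))) →
                 fireProb G (arc r (suc (suc t))) u ≡ 1ℚ
  arc-fireProb {r} {t} {u} {w} fire with arc-fire fire | to (T-firesAt G) (to (∈-fires⇔ G) fire)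
  ... | k<N , inj₁ (ou≡ , _) | u∈S , _ =
    fireProb-one-blue-neighbour G _ u (degree≡2 u) u∈S
      (λ x≡u → ℕₚ.1+n≢n (trans (sym ou≡) (trans (cong (offset r) (sym x≡u)) ox)))
      (from ∈-arc⇔ (subst (_< suc (suc t)) (sym ox) (ℕₚ.m<n⇒m<1+n (ℕₚ.n<1+n t))))
      (from (adjacent⇔ r {u} {x}) (inj₂ (trans ox (sym (trans (cong pred ou≡) (pred-suc t<N))))))
      only
    where
    t<N = ℕₚ.<-trans (ℕₚ.n<1+n t) (ℕₚ.<-trans (ℕₚ.n<1+n (suc t)) k<N)
    x = vertexAt r t
    ox = offset-vertexAt r t<N
    only : ∀ j → T (G u j) → j ∈ arc r (suc (suc t)) → j ≡ x
    only j uj j∈S with to (adjacent⇔ r {u} {j}) uj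
    ... | inj₁ oj≡ = contradiction (subst (_< suc (suc t)) (trans oj≡ (trans (cong succ ou≡) (succ-< (ℕ.s<s⁻¹ k<N))))
                                          (to ∈-arc⇔ j∈S))
                                   (ℕₚ.n≮n _)
    ... | inj₂ oj≡ = to (offset≡⇔ r t<N) (trans oj≡ (trans (cong pred ou≡) (pred-suc t<N)))
  ... | k<N , inj₂ (ou≡0 , _) | u∈S , _ =
    fireProb-one-blue-neighbour G _ u (degree≡2 u) u∈S
      (λ x≡u → ℕₚ.1+n≢0 (trans (sym ox) (trans (cong (offset r) x≡u) ou≡0)))
      (from ∈-arc⇔ (subst (_< suc (suc t)) (sym ox) (s≤s (s≤s z≤n))))
      (from (adjacent⇔ r {u} {x}) (inj₁ (trans ox (sym (trans (cong succ ou≡0) succ-0)))))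
      only
    where
    x = vertexAt r 1
    ox = offset-vertexAt r 1<N
    only : ∀ j → T (G u j) → j ∈ arc r (suc (suc t)) → j ≡ x
    only j uj j∈S with to (adjacent⇔ r {u} {j}) uj
    ... | inj₁ oj≡ = to (offset≡⇔ r 1<N) (trans oj≡ (trans (cong succ ou≡0) succ-0))
    ... | inj₂ oj≡ = contradiction (subst (_< suc (suc t)) (trans oj≡ (trans (cong pred ou≡0) pred-0)) (to ∈-arc⇔ j∈S))
                                   (ℕₚ.<⇒≱ k<N)

  probAllBlue-arc : ∀ ℓ r t → probAllBlue G ℓ (arc r (suc (suc t))) ≡ arcProb N (suc (suc t)) ℓ
  probAllBlue-arc zero r t =
    cong indicator (trans (allBlue-arc r (suc (suc t))) (cong (N ≤ᵇ_) (sym (ℕₚ.+-identityʳ (suc (suc t))))))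
  probAllBlue-arc (suc ℓ) r t = begin
    expectFires G S (fires G S) S (probAllBlue G ℓ) ≡⟨ expectFires-certain G S _ (fires G S) S arc-fireProb ⟩
    probAllBlue G ℓ (addTargets (fires G S) S)     ≡⟨ cong (probAllBlue G ℓ) arc-grows ⟩
    probAllBlue G ℓ (arc (suc r) (4 + t))          ≡⟨ probAllBlue-arc ℓ (suc r) (suc (suc t)) ⟩
    arcProb N (4 + t) ℓ                            ≡⟨ arcProb-suc N (2 + t) ℓ ⟩
    arcProb N (2 + t) (suc ℓ)                      ∎
    where
    open ≡-Reasoning
    S = arc r (suc (suc t))

  module _ (v : Fin N) where

    private
      c = centre v
      x = vertexAt c 1
      y = vertexAt c m
      S = ⁅ v ⁆

      x≢v : x ≢ v
      x≢v x≡v = ℕₚ.1+n≢0 (trans (sym (offset-vertexAt c 1<N)) (trans (cong (offset c) x≡v) (offset-centre v)))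

      y≢v : y ≢ v
      y≢v y≡v = ℕₚ.<⇒≢ (ℕₚ.<-trans (s≤s z≤n) 2≤m)
        (sym (trans (sym (offset-vertexAt c m<N)) (trans (cong (offset c) y≡v) (offset-centre v))))

      S∪x : S ∪ ⁅ x ⁆ ≡ arc c 2
      S∪x = trans (cong (_∪ ⁅ x ⁆) (⁅⁆≡arc v)) (arc-∪-next c 1<N)

      S∪y : S ∪ ⁅ y ⁆ ≡ arc (suc c) 2
      S∪y = trans (cong (_∪ ⁅ y ⁆) (⁅⁆≡arc v)) (arc-∪-last c)

      S∪x∪y : (S ∪ ⁅ x ⁆) ∪ ⁅ y ⁆ ≡ arc (suc c) 3
      S∪x∪y = trans (cong (_∪ ⁅ y ⁆) S∪x) (arc-∪-last c)

      S∪y∪x : (S ∪ ⁅ y ⁆) ∪ ⁅ x ⁆ ≡ arc (suc c) 3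
      S∪y∪x = trans (xy∙z≈xz∙y S ⁅ y ⁆ ⁅ x ⁆) S∪x∪y
        where open CommutativeSemigroupProperties (CommutativeMonoid.commutativeSemigroup (∪-commutativeMonoid N))

      fireProb-v : fireProb G S v ≡ ½
      fireProb-v = fireProb-no-blue-neighbour G S v (degree≡2 v) (x∈⁅x⁆ v)
        (λ j vj j∈S → [ x≢v ∘ sym , y≢v ∘ sym ]′ (to neighbours⇔ (subst (T ∘ G v) (x∈⁅y⁆⇒x≡y v j∈S) vj)))

      arc-value : ∀ ℓ {T r t} → T ≡ arc r (suc (suc t)) → probAllBlue G ℓ T ≡ arcProb N (suc (suc t)) ℓ
      arc-value ℓ {r = r} {t} refl = probAllBlue-arc ℓ r t

      first-round : ∀ ℓ {a b} → let f = probAllBlue G ℓ in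
        f ((S ∪ ⁅ a ⁆) ∪ ⁅ b ⁆) ≡ arcProb N 3 ℓ → f (S ∪ ⁅ a ⁆) ≡ arcProb N 2 ℓ →
        f (S ∪ ⁅ b ⁆) ≡ arcProb N 2 ℓ → f S ≡ singletonProb N ℓ →
        expectFires G S ((v , a) ∷ (v , b) ∷ []) S f ≡ singletonProb N (suc ℓ)
      first-round ℓ fab fa fb fS =
        trans (expectFires-halves G S (probAllBlue G ℓ) S fireProb-v fireProb-v)
              (trans (cong₂ ℚ._+_ (cong₂ ℚ._+_ (cong₂ ℚ._+_ (cong (¼ *_) fab) (cong (¼ *_) fa)) (cong (¼ *_) fb))
                                  (cong (¼ *_) fS))
                     (quarters (arcProb N 3 ℓ) (arcProb N 2 ℓ) (singletonProb N ℓ)))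
        where
        open ℚSolver.+-*-Solver
        quarters : ∀ p q s → ¼ * p ℚ.+ ¼ * q ℚ.+ ¼ * q ℚ.+ ¼ * s ≡ ¼ * p ℚ.+ ½ * q ℚ.+ ¼ * s
        quarters = solve 3 (λ p q s → con ¼ :* p :+ con ¼ :* q :+ con ¼ :* q :+ con ¼ :* s
                                      := con ¼ :* p :+ con ½ :* q :+ con ¼ :* s) refl

    probAllBlue-⁅⁆ : ∀ ℓ → probAllBlue G ℓ ⁅ v ⁆ ≡ singletonProb N ℓ
    probAllBlue-⁅⁆ zero = indicator-false (λ all-blue → x≢v (x∈⁅y⁆⇒x≡y v (to T-allBlue all-blue x)))
    probAllBlue-⁅⁆ (suc ℓ) with fires-⁅⁆ G (neighbours-distinct v) x≢v y≢v (λ w → neighbours⇔)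
    ... | inj₁ fires≡ = trans (cong (λ fs → expectFires G S fs S (probAllBlue G ℓ)) fires≡)
      (first-round ℓ (arc-value ℓ S∪x∪y) (arc-value ℓ S∪x) (arc-value ℓ S∪y) (probAllBlue-⁅⁆ ℓ))
    ... | inj₂ fires≡ = trans (cong (λ fs → expectFires G S fs S (probAllBlue G ℓ)) fires≡)
      (first-round ℓ (arc-value ℓ S∪y∪x) (arc-value ℓ S∪y) (arc-value ℓ S∪x) (probAllBlue-⁅⁆ ℓ))

  P-cycle : ∀ ℓ → P G ℓ ≡ singletonProb N ℓ
  P-cycle ℓ = P-const G ℓ (singletonProb-nonneg N ℓ) (λ v → probAllBlue-⁅⁆ v ℓ)

proposition4p2 : (n : ℕ) → 2 < n → (ℓ : ℕ) → 1 ≤ ℓ →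
    (ℓ < n / 2 → P (cycle n) ℓ ≡ 0ℚ) ×
    (n / 2 ≤ ℓ →
      (n % 2 ≡ 0 → P (cycle n) ℓ ≡ 1ℚ - ((+ 1 /ℚ 4) ^ℚ (ℓ ∸ n / 2 + 1))) ×
      (n % 2 ≡ 1 → P (cycle n) ℓ ≡ 1ℚ - (+ 3 /ℚ 4) * ((+ 1 /ℚ 4) ^ℚ (ℓ ∸ (n ∸ 1) / 2))))
proposition4p2 n@(suc m) 2<n@(s≤s 2≤m) ℓ _ =
    (λ ℓ<h → trans (P-cycle ℓ) (singletonProb-early (n/2+n/2≤n n) ℓ<h))
  , λ h≤ℓ →
      (λ even → trans (P-cycle ℓ) (singletonProb-even 2<n (n%2≡0⇒n≡n/2+n/2 n even) h≤ℓ))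
    , (λ odd → trans (P-cycle ℓ)
                     (subst (λ k → singletonProb n ℓ ≡ 1ℚ - ¾ * ¼ ^ℚ (ℓ ∸ k)) (sym (n%2≡1⇒[n∸1]/2≡n/2 n odd))
                            (singletonProb-odd 2<n (n%2≡1⇒n≡1+n/2+n/2 n odd) h≤ℓ)))
  where open Cycle m 2≤m using (P-cycle)
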